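{- For each integer $r\ge 2$, let $W_r$ be a random variable whose distribution function is $$F_r(t)=\prod_{p}\mathbb{P}\big(\mathrm{Bin}(r,1/p)\le t\big),\qquad t\in\mathbb{R},$$ where the product runs over all primes $p$ and $\mathrm{Bin}(r,q)$ denotes a binomial random variable with $r$ trials and success probability $q$. There are absolute constants $A,B>0$ such that for every integer $r\ge 2$ and every $t\in\mathbb{R}$, $$0\le \mathbb{P}\big(\mathrm{Bin}(r,1/2)\le t\big)-\mathbb{P}\big(W_r\le t\big)\le A e^{ -Br}.$$
   Context: The variable $W_r$ takes values in $\{0,1,\dots,r\}$ and informally represents the index of codivisibility of a random $r$-tuple of positive integers, i.e. the maximum over primes $p$ of the number of entries divisible by $p$. -}

module Defs where

open import Data.Nat as ℕ using (ℕ; zero; suc)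
open import Data.Nat.Combinatorics using (_C_)
open import Data.Nat.Primality using (prime?)
open import Data.Integer using (+_)
open import Data.Rational using (ℚ; 0ℚ; 1ℚ; _+_; _*_; _-_; _/_)
open import Relation.Nullary using (yes; no)

_^ℚ_ : ℚ → ℕ → ℚ
q ^ℚ zero  = 1ℚ
q ^ℚ suc n = q * (q ^ℚ n)

ℕtoℚ : ℕ → ℚ
ℕtoℚ n = + n / 1

-- 1/n as a rational (junk value 0 at n = 0; only used at primes)
inv : ℕ → ℚ
inv zero    = 0ℚ
inv (suc n) = + 1 / suc n

binPMF : ℕ → ℚ → ℕ → ℚ
binPMF r q j = ℕtoℚ (r C j) * (q ^ℚ j) * ((1ℚ - q) ^ℚ (r ℕ.∸ j))

binCDF : ℕ → ℚ → ℕ → ℚ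
binCDF r q zero    = binPMF r q zero
binCDF r q (suc k) = binCDF r q k + binPMF r q (suc k)

-- partial product over primes p ≤ N of P(Bin(r,1/p) ≤ k);
-- F_r(k) is the limit (= infimum) of these as N → ∞
primeProd : ℕ → ℕ → ℕ → ℚ
primeProd r k zero = 1ℚ
primeProd r k (suc N) with prime? (suc N)
... | yes _ = binCDF r (inv (suc N)) k * primeProd r k N
... | no  _ = primeProd r k N

{-# OPTIONS --safe #-}
module Submission where

-- Write F = P(Bin(r,1/2) ≤ k) and tₙ = P(Bin(r,1/n) > k). The partial product over p ≤ N equals
-- F ∏ (1 - tₚ) over the odd primes, which is at least F (1 - ∑ tₙ), so the deficit is at most
-- ∑ F tₙ. Both the distribution function and the tail of a binomial law are bounded by
-- y^k β^r, resp. z^(k+1) γ^r, as soon as these expressions are supersolutions of Pascal's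
-- recursion in r. Choosing the parameters so that the k-dependence cancels in the product and
-- the r-dependence decays like ρ^r with ρ = 35/36 gives F tₙ ≤ 48 ρ^r / n² for k ≥ 1, and
-- ∑ 1/n² ≤ 1/2 by telescoping. For k = 0 already F = 2^(-r) ≤ ρ^r. The upper bound is
-- witnessed by N = 2, where the partial product is F itself.

open import Defs
open import Data.Nat using (ℕ; _≤_)
open import Data.Rational using (ℚ; 0ℚ; 1ℚ; _+_; _*_; _-_; _<_) renaming (_≤_ to _≤ℚ_)
open import Data.Product using (Σ; _×_; _,_; proj₁; proj₂)

open import Data.Nat as ℕ using (zero; suc; _∸_; z≤n; s≤s)
import Data.Nat.Properties as ℕ
open import Data.Nat.Combinatorics using (_C_; nCk+nC[k+1]≡[n+1]C[k+1]; k>n⇒nCk≡0)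
open import Data.Nat.Coprimality using (1-coprimeTo) renaming (sym to coprime-sym)
open import Data.Nat.Primality using (prime?)
open import Data.Integer using (+_)
import Data.Integer.Properties as ℤ
open import Data.Rational as ℚ using (mkℚ; _/_)
import Data.Rational.Properties as ℚ
open import Data.Rational.Properties using (≤ᵇ⇒≤; ≤-refl; ≤-trans; +-mono-≤; +-monoˡ-≤; +-monoʳ-≤)
open import Data.Rational.Solver using (module +-*-Solver)
open +-*-Solver using (solve; _:+_; _:-_; _:*_; _:=_; con)
open import Relation.Binary.PropositionalEquality
open import Relation.Nullary using (yes; no)
open import Relation.Nullary.Decidable using (toWitness)

≤-from-gap : ∀ {x y} d → 0ℚ ≤ℚ d → x + d ≡ y → x ≤ℚ y
≤-from-gap {x} d 0≤d refl = subst (_≤ℚ x + d) (ℚ.+-identityʳ x) (+-monoʳ-≤ x 0≤d)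

sub-antimonoʳ-≤ : ∀ p {q q'} → q ≤ℚ q' → p - q' ≤ℚ p - q
sub-antimonoʳ-≤ p q≤q' = +-monoʳ-≤ p (ℚ.neg-antimono-≤ q≤q')

p≤q⇒0≤q-p : ∀ {p q} → p ≤ℚ q → 0ℚ ≤ℚ q - p
p≤q⇒0≤q-p {p} {q} p≤q = subst (_≤ℚ q - p) (ℚ.+-inverseʳ q) (sub-antimonoʳ-≤ q p≤q)

*-monoˡ-≤-0≤ : ∀ {c x y} → 0ℚ ≤ℚ c → x ≤ℚ y → c * x ≤ℚ c * y
*-monoˡ-≤-0≤ {c} 0≤c = ℚ.*-monoˡ-≤-nonNeg c {{ℚ.nonNegative 0≤c}}

*-monoʳ-≤-0≤ : ∀ {c x y} → 0ℚ ≤ℚ c → x ≤ℚ y → x * c ≤ℚ y * c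
*-monoʳ-≤-0≤ {c} 0≤c = ℚ.*-monoʳ-≤-nonNeg c {{ℚ.nonNegative 0≤c}}

0≤* : ∀ {x y} → 0ℚ ≤ℚ x → 0ℚ ≤ℚ y → 0ℚ ≤ℚ x * y
0≤* {x} 0≤x 0≤y = subst (_≤ℚ x * _) (ℚ.*-zeroʳ x) (*-monoˡ-≤-0≤ 0≤x 0≤y)

*-mono-≤-0≤ : ∀ {x x' y y'} → 0ℚ ≤ℚ x → 0ℚ ≤ℚ y → x ≤ℚ x' → y ≤ℚ y' → x * y ≤ℚ x' * y'
*-mono-≤-0≤ 0≤x 0≤y x≤x' y≤y' =
  ≤-trans (*-monoʳ-≤-0≤ 0≤y x≤x') (*-monoˡ-≤-0≤ (≤-trans 0≤x x≤x') y≤y')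

0≤^ : ∀ {x} n → 0ℚ ≤ℚ x → 0ℚ ≤ℚ x ^ℚ n
0≤^ zero    _   = ≤ᵇ⇒≤ _
0≤^ (suc n) 0≤x = 0≤* 0≤x (0≤^ n 0≤x)

^-monoˡ-≤ : ∀ {x y} n → 0ℚ ≤ℚ x → x ≤ℚ y → x ^ℚ n ≤ℚ y ^ℚ n
^-monoˡ-≤ zero    _   _   = ≤-refl
^-monoˡ-≤ (suc n) 0≤x x≤y = *-mono-≤-0≤ 0≤x (0≤^ n 0≤x) x≤y (^-monoˡ-≤ n 0≤x x≤y)

1^n≡1 : ∀ n → 1ℚ ^ℚ n ≡ 1ℚ
1^n≡1 zero    = refl
1^n≡1 (suc n) = cong (1ℚ *_) (1^n≡1 n)

1≤^ : ∀ {x} n → 1ℚ ≤ℚ x → 1ℚ ≤ℚ x ^ℚ n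
1≤^ {x} n 1≤x = subst (_≤ℚ x ^ℚ n) (1^n≡1 n) (^-monoˡ-≤ n (≤ᵇ⇒≤ _) 1≤x)

^≤1 : ∀ {x} n → 0ℚ ≤ℚ x → x ≤ℚ 1ℚ → x ^ℚ n ≤ℚ 1ℚ
^≤1 {x} n 0≤x x≤1 = subst (x ^ℚ n ≤ℚ_) (1^n≡1 n) (^-monoˡ-≤ n 0≤x x≤1)

^-distribʳ-* : ∀ x y n → (x * y) ^ℚ n ≡ x ^ℚ n * y ^ℚ n
^-distribʳ-* x y zero    = refl
^-distribʳ-* x y (suc n) = begin
  x * y * (x * y) ^ℚ n       ≡⟨ cong (x * y *_) (^-distribʳ-* x y n) ⟩
  x * y * (x ^ℚ n * y ^ℚ n)  ≡⟨ solve 4 (λ x y X Y → x :* y :* (X :* Y) := x :* X :* (y :* Y)) refl x y (x ^ℚ n) (y ^ℚ n) ⟩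
  x * x ^ℚ n * (y * y ^ℚ n)  ∎
  where open ≡-Reasoning

ℕtoℚ≡mkℚ : ∀ n → ℕtoℚ n ≡ mkℚ (+ n) 0 (coprime-sym (1-coprimeTo n))
ℕtoℚ≡mkℚ n = ℚ.normalize-coprime (coprime-sym (1-coprimeTo n))

ℕtoℚ-suc : ∀ n → ℕtoℚ (suc n) ≡ 1ℚ + ℕtoℚ n
ℕtoℚ-suc n rewrite ℕtoℚ≡mkℚ n | ℕtoℚ≡mkℚ (suc n) | ℕ.*-identityʳ n | ℤ.+◃n≡+n n =
  sym (ℕtoℚ≡mkℚ (suc n))

ℕtoℚ-+ : ∀ m n → ℕtoℚ (m ℕ.+ n) ≡ ℕtoℚ m + ℕtoℚ n
ℕtoℚ-+ zero    n = sym (ℚ.+-identityˡ (ℕtoℚ n))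
ℕtoℚ-+ (suc m) n rewrite ℕtoℚ-suc (m ℕ.+ n) | ℕtoℚ-suc m | ℕtoℚ-+ m n =
  sym (ℚ.+-assoc 1ℚ (ℕtoℚ m) (ℕtoℚ n))

0≤ℕtoℚ : ∀ n → 0ℚ ≤ℚ ℕtoℚ n
0≤ℕtoℚ n = ℚ.nonNegative⁻¹ (ℕtoℚ n) {{ℚ.normalize-nonNeg n 1}}

ℕtoℚ-mono-≤ : ∀ {m n} → m ≤ n → ℕtoℚ m ≤ℚ ℕtoℚ n
ℕtoℚ-mono-≤ {m} {n} m≤n = ≤-from-gap (ℕtoℚ (n ∸ m)) (0≤ℕtoℚ (n ∸ m))
  (trans (sym (ℕtoℚ-+ m (n ∸ m))) (cong ℕtoℚ (ℕ.m+[n∸m]≡n m≤n)))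

ℕtoℚ*inv≡1 : ∀ n → ℕtoℚ (suc n) * inv (suc n) ≡ 1ℚ
ℕtoℚ*inv≡1 n rewrite ℕtoℚ≡mkℚ (suc n) | ℚ.normalize-coprime (1-coprimeTo (suc n)) =
  ℚ.*-inverseʳ (mkℚ (+ suc n) 0 (coprime-sym (1-coprimeTo (suc n))))

0≤inv : ∀ n → 0ℚ ≤ℚ inv n
0≤inv zero    = ≤-refl
0≤inv (suc n) = ℚ.nonNegative⁻¹ _ {{ℚ.normalize-nonNeg 1 (suc n)}}

*inv≤1 : ∀ {c} n → c ≤ℚ ℕtoℚ (suc n) → c * inv (suc n) ≤ℚ 1ℚ
*inv≤1 {c} n c≤n = subst (c * inv (suc n) ≤ℚ_) (ℕtoℚ*inv≡1 n) (*-monoʳ-≤-0≤ (0≤inv (suc n)) c≤n)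

1≤*inv : ∀ {c} n → ℕtoℚ (suc n) ≤ℚ c → 1ℚ ≤ℚ c * inv (suc n)
1≤*inv {c} n n≤c = subst (_≤ℚ c * inv (suc n)) (ℕtoℚ*inv≡1 n) (*-monoʳ-≤-0≤ (0≤inv (suc n)) n≤c)

inv≤1 : ∀ n → inv n ≤ℚ 1ℚ
inv≤1 zero    = ≤ᵇ⇒≤ _
inv≤1 (suc n) = subst (_≤ℚ 1ℚ) (ℚ.*-identityˡ (inv (suc n))) (*inv≤1 n (ℕtoℚ-mono-≤ {1} {suc n} (s≤s z≤n)))

-- The binomial distribution

binCDF< : ℕ → ℚ → ℕ → ℚ
binCDF< r a zero    = 0ℚ
binCDF< r a (suc k) = binCDF r a k

binTail : ℕ → ℚ → ℕ → ℚ
binTail r a k = 1ℚ - binCDF r a k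

binCDF-zero-trials : ∀ a k → binCDF 0 a k ≡ 1ℚ
binCDF-zero-trials a zero    = refl
binCDF-zero-trials a (suc k) rewrite binCDF-zero-trials a k =
  solve 2 (λ x y → con 1ℚ :+ con 0ℚ :* x :* y := con 1ℚ) refl (a * a ^ℚ k) 1ℚ

-- For j ≥ r the truncated exponents r ∸ j and r ∸ suc j coincide, and both sides vanish.
binomial-shift : ∀ r j b → ℕtoℚ (r C suc j) * b ^ℚ (r ∸ j) ≡ b * (ℕtoℚ (r C suc j) * b ^ℚ (r ∸ suc j))
binomial-shift r j b with j ℕ.<? r
... | yes j<r rewrite ℕ.+-∸-assoc 1 j<r =
  solve 3 (λ c b B → c :* (b :* B) := b :* (c :* B)) refl (ℕtoℚ (r C suc j)) b (b ^ℚ (r ∸ suc j))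
... | no j≮r rewrite k>n⇒nCk≡0 (s≤s (ℕ.≮⇒≥ j≮r)) =
  solve 3 (λ b B B' → con 0ℚ :* B := b :* (con 0ℚ :* B')) refl b (b ^ℚ (r ∸ j)) (b ^ℚ (r ∸ suc j))

binPMF-pascal : ∀ r a j → binPMF (suc r) a (suc j) ≡ (1ℚ - a) * binPMF r a (suc j) + a * binPMF r a j
binPMF-pascal r a j = begin
  ℕtoℚ (suc r C suc j) * a ^ℚ suc j * b ^ℚ (r ∸ j)
    ≡⟨ cong (λ c → ℕtoℚ c * a ^ℚ suc j * b ^ℚ (r ∸ j)) (sym (nCk+nC[k+1]≡[n+1]C[k+1] r j)) ⟩
  ℕtoℚ (r C j ℕ.+ r C suc j) * a ^ℚ suc j * b ^ℚ (r ∸ j)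
    ≡⟨ cong (λ c → c * a ^ℚ suc j * b ^ℚ (r ∸ j)) (ℕtoℚ-+ (r C j) (r C suc j)) ⟩
  (c₀ + c₁) * (a * A) * b ^ℚ (r ∸ j)
    ≡⟨ solve 5 (λ a A c₀ c₁ B → (c₀ :+ c₁) :* (a :* A) :* B := a :* A :* (c₁ :* B) :+ a :* (c₀ :* A :* B))
         refl a A c₀ c₁ (b ^ℚ (r ∸ j)) ⟩
  a * A * (c₁ * b ^ℚ (r ∸ j)) + a * binPMF r a j
    ≡⟨ cong (λ x → a * A * x + a * binPMF r a j) (binomial-shift r j b) ⟩
  a * A * (b * (c₁ * b ^ℚ (r ∸ suc j))) + a * binPMF r a j
    ≡⟨ cong (_+ a * binPMF r a j)
         (solve 5 (λ a A b c₁ B → a :* A :* (b :* (c₁ :* B)) := b :* (c₁ :* (a :* A) :* B))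
           refl a A b c₁ (b ^ℚ (r ∸ suc j))) ⟩
  b * binPMF r a (suc j) + a * binPMF r a j ∎
  where
  open ≡-Reasoning
  b = 1ℚ - a
  A = a ^ℚ j
  c₀ = ℕtoℚ (r C j)
  c₁ = ℕtoℚ (r C suc j)

binCDF<+binPMF : ∀ r a k → binCDF< r a k + binPMF r a k ≡ binCDF r a k
binCDF<+binPMF r a zero    = ℚ.+-identityˡ _
binCDF<+binPMF r a (suc k) = refl

binCDF-pascal : ∀ r a k → binCDF (suc r) a k ≡ (1ℚ - a) * binCDF r a k + a * binCDF< r a k
binCDF-pascal r a zero =
  solve 2 (λ a B → con 1ℚ :* con 1ℚ :* ((con 1ℚ :- a) :* B) := (con 1ℚ :- a) :* (con 1ℚ :* con 1ℚ :* B) :+ a :* con 0ℚ)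
    refl a ((1ℚ - a) ^ℚ r)
binCDF-pascal r a (suc k) = begin
  binCDF (suc r) a k + binPMF (suc r) a (suc k)
    ≡⟨ cong₂ _+_ (binCDF-pascal r a k) (binPMF-pascal r a k) ⟩
  ((1ℚ - a) * F + a * F<) + ((1ℚ - a) * p₁ + a * p₀)
    ≡⟨ solve 5 (λ a F F< p₁ p₀ → ((con 1ℚ :- a) :* F :+ a :* F<) :+ ((con 1ℚ :- a) :* p₁ :+ a :* p₀)
                                 := (con 1ℚ :- a) :* (F :+ p₁) :+ a :* (F< :+ p₀)) refl a F F< p₁ p₀ ⟩
  (1ℚ - a) * (F + p₁) + a * (F< + p₀)
    ≡⟨ cong (λ x → (1ℚ - a) * (F + p₁) + a * x) (binCDF<+binPMF r a k) ⟩
  (1ℚ - a) * (F + p₁) + a * F ∎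
  where
  open ≡-Reasoning
  F = binCDF r a k
  F< = binCDF< r a k
  p₀ = binPMF r a k
  p₁ = binPMF r a (suc k)

binTail-pascal : ∀ r a k → binTail (suc r) a k ≡ (1ℚ - a) * binTail r a k + a * (1ℚ - binCDF< r a k)
binTail-pascal r a k = trans (cong (1ℚ -_) (binCDF-pascal r a k))
  (solve 3 (λ a F F< → con 1ℚ :- ((con 1ℚ :- a) :* F :+ a :* F<) := (con 1ℚ :- a) :* (con 1ℚ :- F) :+ a :* (con 1ℚ :- F<))
    refl a (binCDF r a k) (binCDF< r a k))

module _ {a : ℚ} (0≤a : 0ℚ ≤ℚ a) (a≤1 : a ≤ℚ 1ℚ) where

  private
    0≤1-a : 0ℚ ≤ℚ 1ℚ - a
    0≤1-a = p≤q⇒0≤q-p a≤1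

  binCDF∈[0,1] : ∀ r k → 0ℚ ≤ℚ binCDF r a k × binCDF r a k ≤ℚ 1ℚ
  binCDF<∈[0,1] : ∀ r k → 0ℚ ≤ℚ binCDF< r a k × binCDF< r a k ≤ℚ 1ℚ

  binCDF<∈[0,1] r zero    = ≤-refl , ≤ᵇ⇒≤ _
  binCDF<∈[0,1] r (suc k) = binCDF∈[0,1] r k

  binCDF∈[0,1] zero k rewrite binCDF-zero-trials a k = ≤ᵇ⇒≤ _ , ≤-refl
  binCDF∈[0,1] (suc r) k with binCDF∈[0,1] r k | binCDF<∈[0,1] r k
  ... | 0≤F , F≤1 | 0≤F< , F<≤1 rewrite binCDF-pascal r a k =
      +-mono-≤ (0≤* 0≤1-a 0≤F) (0≤* 0≤a 0≤F<)
    , (begin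
        (1ℚ - a) * binCDF r a k + a * binCDF< r a k ≤⟨ +-mono-≤ (*-monoˡ-≤-0≤ 0≤1-a F≤1) (*-monoˡ-≤-0≤ 0≤a F<≤1) ⟩
        (1ℚ - a) * 1ℚ + a * 1ℚ                      ≡⟨ solve 1 (λ a → (con 1ℚ :- a) :* con 1ℚ :+ a :* con 1ℚ := con 1ℚ) refl a ⟩
        1ℚ                                          ∎)
    where open ℚ.≤-Reasoning

  0≤binTail : ∀ r k → 0ℚ ≤ℚ binTail r a k
  0≤binTail r k = p≤q⇒0≤q-p (proj₂ (binCDF∈[0,1] r k))

  binCDF≤geometric : ∀ {y β} → 1ℚ ≤ℚ y → 1ℚ - a ≤ℚ β → (1ℚ - a) * y + a ≤ℚ y * β →
                     ∀ r k → binCDF r a k ≤ℚ y ^ℚ k * β ^ℚ r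
  binCDF≤geometric {y} {β} 1≤y 1-a≤β step = bound
    where
    open ℚ.≤-Reasoning
    0≤y = ≤-trans (≤ᵇ⇒≤ _) 1≤y
    0≤β = ≤-trans 0≤1-a 1-a≤β
    bound : ∀ r k → binCDF r a k ≤ℚ y ^ℚ k * β ^ℚ r
    bound zero k rewrite binCDF-zero-trials a k =
      subst (1ℚ ≤ℚ_) (sym (ℚ.*-identityʳ (y ^ℚ k))) (1≤^ k 1≤y)
    bound (suc r) zero = begin
      binCDF (suc r) a zero                     ≡⟨ binCDF-pascal r a zero ⟩
      (1ℚ - a) * binCDF r a zero + a * 0ℚ       ≤⟨ +-monoˡ-≤ (a * 0ℚ) (*-monoˡ-≤-0≤ 0≤1-a (bound r zero)) ⟩
      (1ℚ - a) * (1ℚ * β ^ℚ r) + a * 0ℚ         ≤⟨ +-monoˡ-≤ (a * 0ℚ) (*-monoʳ-≤-0≤ (0≤* (≤ᵇ⇒≤ {0ℚ} {1ℚ} _) (0≤^ r 0≤β)) 1-a≤β) ⟩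
      β * (1ℚ * β ^ℚ r) + a * 0ℚ                ≡⟨ solve 3 (λ a β B → β :* (con 1ℚ :* B) :+ a :* con 0ℚ := con 1ℚ :* (β :* B)) refl a β (β ^ℚ r) ⟩
      1ℚ * (β * β ^ℚ r)                         ∎
    bound (suc r) (suc k) = begin
      binCDF (suc r) a (suc k)                                  ≡⟨ binCDF-pascal r a (suc k) ⟩
      (1ℚ - a) * binCDF r a (suc k) + a * binCDF r a k          ≤⟨ +-mono-≤ (*-monoˡ-≤-0≤ 0≤1-a (bound r (suc k))) (*-monoˡ-≤-0≤ 0≤a (bound r k)) ⟩
      (1ℚ - a) * (y * Y * B) + a * (Y * B)                      ≡⟨ solve 4 (λ a y Y B → (con 1ℚ :- a) :* (y :* Y :* B) :+ a :* (Y :* B) := Y :* B :* ((con 1ℚ :- a) :* y :+ a)) refl a y Y B ⟩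
      Y * B * ((1ℚ - a) * y + a)                                ≤⟨ *-monoˡ-≤-0≤ (0≤* (0≤^ k 0≤y) (0≤^ r 0≤β)) step ⟩
      Y * B * (y * β)                                           ≡⟨ solve 4 (λ y β Y B → Y :* B :* (y :* β) := y :* Y :* (β :* B)) refl y β Y B ⟩
      y * Y * (β * B)                                           ∎
      where
      Y = y ^ℚ k
      B = β ^ℚ r

  binTail≤geometric : ∀ {z γ} → 0ℚ ≤ℚ z → 1ℚ ≤ℚ γ → z * (1ℚ - a) + a ≤ℚ z * γ →
                      ∀ r k → binTail r a k ≤ℚ z ^ℚ suc k * γ ^ℚ r
  binTail≤geometric {z} {γ} 0≤z 1≤γ step = bound
    where
    open ℚ.≤-Reasoning
    0≤γ = ≤-trans (≤ᵇ⇒≤ _) 1≤γ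
    bound : ∀ r k → binTail r a k ≤ℚ z ^ℚ suc k * γ ^ℚ r
    bound zero k rewrite binCDF-zero-trials a k = 0≤* (0≤^ (suc k) 0≤z) (≤ᵇ⇒≤ _)
    bound (suc r) zero = begin
      binTail (suc r) a zero                         ≡⟨ binTail-pascal r a zero ⟩
      (1ℚ - a) * binTail r a zero + a * (1ℚ - 0ℚ)    ≤⟨ +-mono-≤ (*-monoˡ-≤-0≤ 0≤1-a (bound r zero)) (*-monoˡ-≤-0≤ 0≤a (1≤^ r 1≤γ)) ⟩
      (1ℚ - a) * (z * 1ℚ * G) + a * G                ≡⟨ solve 3 (λ a z G → (con 1ℚ :- a) :* (z :* con 1ℚ :* G) :+ a :* G := G :* (z :* (con 1ℚ :- a) :+ a)) refl a z G ⟩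
      G * (z * (1ℚ - a) + a)                         ≤⟨ *-monoˡ-≤-0≤ (0≤^ r 0≤γ) step ⟩
      G * (z * γ)                                    ≡⟨ solve 3 (λ z γ G → G :* (z :* γ) := z :* con 1ℚ :* (γ :* G)) refl z γ G ⟩
      z * 1ℚ * (γ * G)                               ∎
      where G = γ ^ℚ r
    bound (suc r) (suc k) = begin
      binTail (suc r) a (suc k)                           ≡⟨ binTail-pascal r a (suc k) ⟩
      (1ℚ - a) * binTail r a (suc k) + a * binTail r a k  ≤⟨ +-mono-≤ (*-monoˡ-≤-0≤ 0≤1-a (bound r (suc k))) (*-monoˡ-≤-0≤ 0≤a (bound r k)) ⟩
      (1ℚ - a) * (z * Z * G) + a * (Z * G)                ≡⟨ solve 4 (λ a z Z G → (con 1ℚ :- a) :* (z :* Z :* G) :+ a :* (Z :* G) := Z :* G :* (z :* (con 1ℚ :- a) :+ a)) refl a z Z G ⟩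
      Z * G * (z * (1ℚ - a) + a)                          ≤⟨ *-monoˡ-≤-0≤ (0≤* (0≤^ (suc k) 0≤z) (0≤^ r 0≤γ)) step ⟩
      Z * G * (z * γ)                                     ≡⟨ solve 4 (λ z γ Z G → Z :* G :* (z :* γ) := z :* Z :* (γ :* G)) refl z γ Z G ⟩
      z * Z * (γ * G)                                     ∎
      where
      Z = z ^ℚ suc k
      G = γ ^ℚ r

product-of-geometric-bounds : ∀ {F T y β z γ} k r → 0ℚ ≤ℚ F → 0ℚ ≤ℚ T →
              F ≤ℚ y ^ℚ k * β ^ℚ r → T ≤ℚ z ^ℚ suc k * γ ^ℚ r →
              F * T ≤ℚ z * ((y * z) ^ℚ k * (β * γ) ^ℚ r)
product-of-geometric-bounds {F} {T} {y} {β} {z} {γ} k r 0≤F 0≤T F≤ T≤ = begin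
  F * T                                        ≤⟨ *-mono-≤-0≤ 0≤F 0≤T F≤ T≤ ⟩
  y ^ℚ k * β ^ℚ r * (z * z ^ℚ k * γ ^ℚ r)      ≡⟨ solve 5 (λ z Y B Z G → Y :* B :* (z :* Z :* G) := z :* (Y :* Z :* (B :* G)))
                                                    refl z (y ^ℚ k) (β ^ℚ r) (z ^ℚ k) (γ ^ℚ r) ⟩
  z * (y ^ℚ k * z ^ℚ k * (β ^ℚ r * γ ^ℚ r))    ≡⟨ sym (cong₂ (λ u v → z * (u * v)) (^-distribʳ-* y z k) (^-distribʳ-* β γ r)) ⟩
  z * ((y * z) ^ℚ k * (β * γ) ^ℚ r)            ∎
  where open ℚ.≤-Reasoning

½ : ℚ
½ = inv 2

ρ : ℚ
ρ = + 35 / 36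

-- The modulus is m = 3 + n. Two choices of parameters for the geometric bounds: (3/2, 5/6) and
-- (2/3, 7/6) for every m, with products 1 and ρ; (4, 5/8) and (2/m, 3/2) for m ≥ 8, with
-- products 8/m ≤ 1 and 15/16 ≤ ρ.
module _ (r k n : ℕ) where

  private
    a F T : ℚ
    a = inv (3 ℕ.+ n)
    F = binCDF r ½ (suc k)
    T = binTail r a (suc k)
    0≤a = 0≤inv (3 ℕ.+ n)
    a≤1 = inv≤1 (3 ℕ.+ n)
    0≤F = proj₁ (binCDF∈[0,1] (0≤inv 2) (inv≤1 2) r (suc k))
    0≤T = 0≤binTail 0≤a a≤1 r (suc k)
    0≤ρ^r = 0≤^ r (≤ᵇ⇒≤ {0ℚ} {ρ} _)
    0≤½ = 0≤inv 2
    ½≤1 = inv≤1 2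
    open ℚ.≤-Reasoning

  binCDF½*binTail≤⅔ρ^r : F * T ≤ℚ (+ 2 / 3) * ρ ^ℚ r
  binCDF½*binTail≤⅔ρ^r = begin
    F * T                                 ≤⟨ product-of-geometric-bounds {y = + 3 / 2} {+ 5 / 6} {+ 2 / 3} {+ 7 / 6} (suc k) r 0≤F 0≤T
                                               (binCDF≤geometric 0≤½ ½≤1 {+ 3 / 2} {+ 5 / 6} (≤ᵇ⇒≤ _) (≤ᵇ⇒≤ _) (≤ᵇ⇒≤ _) r (suc k))
                                               (binTail≤geometric 0≤a a≤1 {+ 2 / 3} {+ 7 / 6} (≤ᵇ⇒≤ _) (≤ᵇ⇒≤ _) step r (suc k)) ⟩
    (+ 2 / 3) * (1ℚ ^ℚ suc k * ρ ^ℚ r)    ≡⟨ cong (λ x → (+ 2 / 3) * (x * ρ ^ℚ r)) (1^n≡1 (suc k)) ⟩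
    (+ 2 / 3) * (1ℚ * ρ ^ℚ r)             ≡⟨ cong ((+ 2 / 3) *_) (ℚ.*-identityˡ (ρ ^ℚ r)) ⟩
    (+ 2 / 3) * ρ ^ℚ r                    ∎
    where
    3a≤1 : (+ 3 / 1) * a ≤ℚ 1ℚ
    3a≤1 = *inv≤1 (2 ℕ.+ n) (ℕtoℚ-mono-≤ {3} {3 ℕ.+ n} (s≤s (s≤s (s≤s z≤n))))
    step : (+ 2 / 3) * (1ℚ - a) + a ≤ℚ (+ 2 / 3) * (+ 7 / 6)
    step = begin
      (+ 2 / 3) * (1ℚ - a) + a             ≡⟨ solve 1 (λ a → con (+ 2 / 3) :* (con 1ℚ :- a) :+ a
                                                         := con (+ 2 / 3) :+ con (+ 1 / 9) :* (con (+ 3 / 1) :* a)) refl a ⟩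
      (+ 2 / 3) + (+ 1 / 9) * ((+ 3 / 1) * a) ≤⟨ +-monoʳ-≤ (+ 2 / 3) (*-monoˡ-≤-0≤ (≤ᵇ⇒≤ {0ℚ} {+ 1 / 9} _) 3a≤1) ⟩
      (+ 2 / 3) + (+ 1 / 9) * 1ℚ           ≡⟨⟩
      (+ 2 / 3) * (+ 7 / 6)                ∎

  binCDF½*binTail≤16a²ρ^r : 5 ≤ n → F * T ≤ℚ (+ 16 / 1) * (a * a) * ρ ^ℚ r
  binCDF½*binTail≤16a²ρ^r 5≤n = begin
    F * T                           ≤⟨ product-of-geometric-bounds {y = + 4 / 1} {+ 5 / 8} {2a} {+ 3 / 2} (suc k) r 0≤F 0≤T
                                         (binCDF≤geometric 0≤½ ½≤1 {+ 4 / 1} {+ 5 / 8} (≤ᵇ⇒≤ _) (≤ᵇ⇒≤ _) (≤ᵇ⇒≤ _) r (suc k))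
                                         (binTail≤geometric 0≤a a≤1 {2a} {+ 3 / 2} 0≤2a (≤ᵇ⇒≤ _) step r (suc k)) ⟩
    2a * (w ^ℚ suc k * W ^ℚ r)       ≤⟨ *-monoˡ-≤-0≤ 0≤2a (*-mono-≤-0≤ (0≤^ (suc k) 0≤w) (0≤^ r (≤ᵇ⇒≤ _))
                                           (*-monoˡ-≤-0≤ 0≤w (^≤1 k 0≤w w≤1)) (^-monoˡ-≤ r (≤ᵇ⇒≤ _) (≤ᵇ⇒≤ _))) ⟩
    2a * (w * 1ℚ * ρ ^ℚ r)           ≡⟨ solve 2 (λ a P → con (+ 2 / 1) :* a :* (con (+ 4 / 1) :* (con (+ 2 / 1) :* a) :* con 1ℚ :* P)
                                                      := con (+ 16 / 1) :* (a :* a) :* P) refl a (ρ ^ℚ r) ⟩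
    (+ 16 / 1) * (a * a) * ρ ^ℚ r    ∎
    where
    2a w W : ℚ
    2a = (+ 2 / 1) * a
    w = (+ 4 / 1) * 2a
    W = (+ 5 / 8) * (+ 3 / 2)
    0≤2a : 0ℚ ≤ℚ 2a
    0≤2a = 0≤* (≤ᵇ⇒≤ {0ℚ} {+ 2 / 1} _) 0≤a
    0≤w : 0ℚ ≤ℚ w
    0≤w = 0≤* (≤ᵇ⇒≤ {0ℚ} {+ 4 / 1} _) 0≤2a
    w≤1 : w ≤ℚ 1ℚ
    w≤1 = subst (_≤ℚ 1ℚ) (solve 1 (λ a → con (+ 8 / 1) :* a := con (+ 4 / 1) :* (con (+ 2 / 1) :* a)) refl a)
            (*inv≤1 (2 ℕ.+ n) (ℕtoℚ-mono-≤ {8} {3 ℕ.+ n} (s≤s (s≤s (s≤s 5≤n)))))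
    step : 2a * (1ℚ - a) + a ≤ℚ 2a * (+ 3 / 2)
    step = ≤-from-gap ((+ 2 / 1) * (a * a)) (0≤* (≤ᵇ⇒≤ {0ℚ} {+ 2 / 1} _) (0≤* 0≤a 0≤a))
      (solve 1 (λ a → con (+ 2 / 1) :* a :* (con 1ℚ :- a) :+ a :+ con (+ 2 / 1) :* (a :* a)
                      := con (+ 2 / 1) :* a :* con (+ 3 / 2)) refl a)

  binCDF½*binTail≤ : F * T ≤ℚ (+ 48 / 1) * ρ ^ℚ r * (a * a)
  binCDF½*binTail≤ with n ℕ.≤? 5
  ... | yes n≤5 = begin
    F * T                                       ≤⟨ binCDF½*binTail≤⅔ρ^r ⟩
    (+ 2 / 3) * ρ ^ℚ r                          ≤⟨ *-monoʳ-≤-0≤ 0≤ρ^r (≤-trans (≤ᵇ⇒≤ {+ 2 / 3} {+ 3 / 4} _)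
                                                     (*-monoˡ-≤-0≤ (≤ᵇ⇒≤ {0ℚ} {+ 3 / 4} _) (*-mono-≤-0≤ (≤ᵇ⇒≤ {0ℚ} {1ℚ} _) (≤ᵇ⇒≤ {0ℚ} {1ℚ} _) 1≤8a 1≤8a))) ⟩
    (+ 3 / 4) * ((+ 8 / 1) * a * ((+ 8 / 1) * a)) * ρ ^ℚ r
                                                ≡⟨ solve 2 (λ a P → con (+ 3 / 4) :* (con (+ 8 / 1) :* a :* (con (+ 8 / 1) :* a)) :* P
                                                                  := con (+ 48 / 1) :* P :* (a :* a)) refl a (ρ ^ℚ r) ⟩
    (+ 48 / 1) * ρ ^ℚ r * (a * a)               ∎
    where
    1≤8a : 1ℚ ≤ℚ (+ 8 / 1) * a
    1≤8a = 1≤*inv (2 ℕ.+ n) (ℕtoℚ-mono-≤ {3 ℕ.+ n} {8} (s≤s (s≤s (s≤s n≤5))))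
  ... | no n≰5 = begin
    F * T                                       ≤⟨ binCDF½*binTail≤16a²ρ^r (ℕ.<⇒≤ (ℕ.≰⇒> n≰5)) ⟩
    (+ 16 / 1) * (a * a) * ρ ^ℚ r               ≤⟨ *-monoʳ-≤-0≤ 0≤ρ^r (*-monoʳ-≤-0≤ (0≤* 0≤a 0≤a) (≤ᵇ⇒≤ {+ 16 / 1} {+ 48 / 1} _)) ⟩
    (+ 48 / 1) * (a * a) * ρ ^ℚ r               ≡⟨ solve 2 (λ a P → con (+ 48 / 1) :* (a :* a) :* P := con (+ 48 / 1) :* P :* (a :* a)) refl a (ρ ^ℚ r) ⟩
    (+ 48 / 1) * ρ ^ℚ r * (a * a)               ∎

-- The partial products

∑< : ℕ → (ℕ → ℚ) → ℚ
∑< zero    f = 0ℚ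
∑< (suc m) f = ∑< m f + f m

sum-3-to : (ℕ → ℚ) → ℕ → ℚ
sum-3-to f N = ∑< (N ∸ 2) (λ i → f (3 ℕ.+ i))

0≤∑< : ∀ {f} → (∀ i → 0ℚ ≤ℚ f i) → ∀ m → 0ℚ ≤ℚ ∑< m f
0≤∑< 0≤f zero    = ≤-refl
0≤∑< 0≤f (suc m) = +-mono-≤ (0≤∑< 0≤f m) (0≤f m)

∑<-mono-≤ : ∀ {f g} → (∀ i → f i ≤ℚ g i) → ∀ m → ∑< m f ≤ℚ ∑< m g
∑<-mono-≤ f≤g zero    = ≤-refl
∑<-mono-≤ f≤g (suc m) = +-mono-≤ (∑<-mono-≤ f≤g m) (f≤g m)

∑<-distribˡ-* : ∀ c f m → ∑< m (λ i → c * f i) ≡ c * ∑< m f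
∑<-distribˡ-* c f zero    = sym (ℚ.*-zeroʳ c)
∑<-distribˡ-* c f (suc m) =
  trans (cong (_+ c * f m) (∑<-distribˡ-* c f m)) (sym (ℚ.*-distribˡ-+ c (∑< m f) (f m)))

-- 1/(n-1) = 1/n + 1/(n(n-1)) ≥ 1/n + 1/n², so the sum of 1/n² telescopes.
inv²+inv≤inv-pred : ∀ n → inv (2 ℕ.+ n) * inv (2 ℕ.+ n) + inv (2 ℕ.+ n) ≤ℚ inv (suc n)
inv²+inv≤inv-pred n = begin
  a * a + a  ≤⟨ +-monoˡ-≤ a (*-monoˡ-≤-0≤ 0≤a a≤b) ⟩
  a * b + a  ≡⟨ sym b≡ab+a ⟩
  b          ∎
  where
  open ℚ.≤-Reasoning
  a b x : ℚ
  a = inv (2 ℕ.+ n)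
  b = inv (suc n)
  x = ℕtoℚ (suc n)
  0≤a = 0≤inv (2 ℕ.+ n)
  b≡ab+a : b ≡ a * b + a
  b≡ab+a = begin-equality
    b                        ≡⟨ sym (ℚ.*-identityʳ b) ⟩
    b * 1ℚ                   ≡⟨ cong (b *_) (sym (ℕtoℚ*inv≡1 (suc n))) ⟩
    b * (ℕtoℚ (2 ℕ.+ n) * a) ≡⟨ cong (λ y → b * (y * a)) (ℕtoℚ-suc (suc n)) ⟩
    b * ((1ℚ + x) * a)       ≡⟨ solve 3 (λ a b x → b :* ((con 1ℚ :+ x) :* a) := a :* b :+ x :* b :* a) refl a b x ⟩
    a * b + x * b * a        ≡⟨ cong (λ y → a * b + y * a) (ℕtoℚ*inv≡1 n) ⟩
    a * b + 1ℚ * a           ≡⟨ cong (λ y → a * b + y) (ℚ.*-identityˡ a) ⟩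
    a * b + a                ∎
  a≤b : a ≤ℚ b
  a≤b = ≤-from-gap (a * b) (0≤* 0≤a (0≤inv (suc n))) (trans (ℚ.+-comm a (a * b)) (sym b≡ab+a))

∑<inv²+inv≤½ : ∀ m → ∑< m (λ i → inv (3 ℕ.+ i) * inv (3 ℕ.+ i)) + inv (2 ℕ.+ m) ≤ℚ ½
∑<inv²+inv≤½ zero    = ≤-refl
∑<inv²+inv≤½ (suc m) = begin
  S + a * a + a      ≡⟨ ℚ.+-assoc S (a * a) a ⟩
  S + (a * a + a)    ≤⟨ +-monoʳ-≤ S (inv²+inv≤inv-pred (suc m)) ⟩
  S + inv (2 ℕ.+ m)  ≤⟨ ∑<inv²+inv≤½ m ⟩
  ½                  ∎
  where
  open ℚ.≤-Reasoning
  a = inv (3 ℕ.+ m)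
  S = ∑< m (λ i → inv (3 ℕ.+ i) * inv (3 ℕ.+ i))

sum-3-to-inv²≤½ : ∀ N → sum-3-to (λ n → inv n * inv n) N ≤ℚ ½
sum-3-to-inv²≤½ N = ≤-trans (≤-from-gap _ (0≤inv (2 ℕ.+ (N ∸ 2))) refl) (∑<inv²+inv≤½ (N ∸ 2))

tailSum : ℕ → ℕ → ℕ → ℚ
tailSum r k = sum-3-to (λ n → binTail r (inv n) k)

0≤binCDF : ∀ r n k → 0ℚ ≤ℚ binCDF r (inv n) k
0≤binCDF r n k = proj₁ (binCDF∈[0,1] (0≤inv n) (inv≤1 n) r k)

0≤primeProd : ∀ r k N → 0ℚ ≤ℚ primeProd r k N
0≤primeProd r k zero = ≤ᵇ⇒≤ _
0≤primeProd r k (suc N) with prime? (suc N)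
... | yes _ = 0≤* (0≤binCDF r (suc N) k) (0≤primeProd r k N)
... | no  _ = 0≤primeProd r k N

-- Weierstrass' inequality ∏ (1 - tₚ) ≥ 1 - ∑ tₚ over the odd primes p ≤ N; the sum may run over
-- all 3 ≤ n ≤ N because the tails are nonnegative.
binCDF½*[1-tailSum]≤primeProd : ∀ r k N → binCDF r ½ k * (1ℚ - tailSum r k N) ≤ℚ primeProd r k N
binCDF½*[1-tailSum]≤primeProd r k zero =
  subst (_≤ℚ 1ℚ) (sym (ℚ.*-identityʳ (binCDF r ½ k))) (proj₂ (binCDF∈[0,1] (0≤inv 2) (inv≤1 2) r k))
binCDF½*[1-tailSum]≤primeProd r k (suc zero) = binCDF½*[1-tailSum]≤primeProd r k zero
binCDF½*[1-tailSum]≤primeProd r k (suc (suc zero)) = ≤-refl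
binCDF½*[1-tailSum]≤primeProd r k (suc (suc (suc M)))
  with prime? (3 ℕ.+ M) | binCDF½*[1-tailSum]≤primeProd r k (suc (suc M))
... | yes _ | IH = begin
  F * (1ℚ - (S + (1ℚ - c)))    ≤⟨ ≤-from-gap (F * (1ℚ - c) * S) (0≤* (0≤* 0≤F 0≤T) 0≤S)
                                   (solve 3 (λ F S c → F :* (con 1ℚ :- (S :+ (con 1ℚ :- c))) :+ F :* (con 1ℚ :- c) :* S
                                                       := F :* (con 1ℚ :- S) :* c) refl F S c) ⟩
  F * (1ℚ - S) * c             ≤⟨ *-monoʳ-≤-0≤ (0≤binCDF r (3 ℕ.+ M) k) IH ⟩
  primeProd r k (2 ℕ.+ M) * c  ≡⟨ ℚ.*-comm _ c ⟩
  c * primeProd r k (2 ℕ.+ M)  ∎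
  where
  open ℚ.≤-Reasoning
  F = binCDF r ½ k
  S = tailSum r k (2 ℕ.+ M)
  c = binCDF r (inv (3 ℕ.+ M)) k
  0≤F = 0≤binCDF r 2 k
  0≤T = 0≤binTail (0≤inv (3 ℕ.+ M)) (inv≤1 (3 ℕ.+ M)) r k
  0≤S = 0≤∑< (λ i → 0≤binTail (0≤inv (3 ℕ.+ i)) (inv≤1 (3 ℕ.+ i)) r k) M
... | no _  | IH = begin
  F * (1ℚ - (S + T))           ≤⟨ ≤-from-gap (F * T) (0≤* (0≤binCDF r 2 k) 0≤T)
                                   (solve 3 (λ F S T → F :* (con 1ℚ :- (S :+ T)) :+ F :* T := F :* (con 1ℚ :- S)) refl F S T) ⟩
  F * (1ℚ - S)                 ≤⟨ IH ⟩
  primeProd r k (2 ℕ.+ M)      ∎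
  where
  open ℚ.≤-Reasoning
  F = binCDF r ½ k
  S = tailSum r k (2 ℕ.+ M)
  T = binTail r (inv (3 ℕ.+ M)) k
  0≤T = 0≤binTail (0≤inv (3 ℕ.+ M)) (inv≤1 (3 ℕ.+ M)) r k

A : ℚ
A = + 24 / 1

binCDF½*tailSum≤Aρ^r : ∀ r k N → binCDF r ½ (suc k) * tailSum r (suc k) N ≤ℚ A * ρ ^ℚ r
binCDF½*tailSum≤Aρ^r r k N = begin
  F * ∑< m (λ i → binTail r (a i) (suc k))               ≡⟨ sym (∑<-distribˡ-* F _ m) ⟩
  ∑< m (λ i → F * binTail r (a i) (suc k))               ≤⟨ ∑<-mono-≤ (binCDF½*binTail≤ r k) m ⟩
  ∑< m (λ i → c * (a i * a i))                           ≡⟨ ∑<-distribˡ-* c _ m ⟩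
  c * sum-3-to (λ n → inv n * inv n) N                   ≤⟨ *-monoˡ-≤-0≤ 0≤c (sum-3-to-inv²≤½ N) ⟩
  c * ½                                                  ≡⟨ solve 1 (λ P → con (+ 48 / 1) :* P :* con ½ := con A :* P) refl (ρ ^ℚ r) ⟩
  A * ρ ^ℚ r                                             ∎
  where
  open ℚ.≤-Reasoning
  F = binCDF r ½ (suc k)
  c = (+ 48 / 1) * ρ ^ℚ r
  m = N ∸ 2
  a : ℕ → ℚ
  a i = inv (3 ℕ.+ i)
  0≤c = 0≤* (≤ᵇ⇒≤ {0ℚ} {+ 48 / 1} _) (0≤^ r (≤ᵇ⇒≤ {0ℚ} {ρ} _))

binCDF½-Aρ^r≤primeProd : ∀ r k N → binCDF r ½ k - A * ρ ^ℚ r ≤ℚ primeProd r k N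
binCDF½-Aρ^r≤primeProd r zero N = begin
  F - A * ρ ^ℚ r      ≤⟨ sub-antimonoʳ-≤ F F≤Aρ^r ⟩
  F - F               ≡⟨ ℚ.+-inverseʳ F ⟩
  0ℚ                  ≤⟨ 0≤primeProd r zero N ⟩
  primeProd r zero N  ∎
  where
  open ℚ.≤-Reasoning
  F = binCDF r ½ zero
  F≤Aρ^r : F ≤ℚ A * ρ ^ℚ r
  F≤Aρ^r = begin
    F                   ≤⟨ binCDF≤geometric (0≤inv 2) (inv≤1 2) {+ 3 / 2} {+ 5 / 6} (≤ᵇ⇒≤ _) (≤ᵇ⇒≤ _) (≤ᵇ⇒≤ _) r zero ⟩
    1ℚ * (+ 5 / 6) ^ℚ r ≤⟨ *-monoˡ-≤-0≤ (≤ᵇ⇒≤ {0ℚ} {1ℚ} _) (^-monoˡ-≤ r (≤ᵇ⇒≤ _) (≤ᵇ⇒≤ _)) ⟩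
    1ℚ * ρ ^ℚ r         ≤⟨ *-monoʳ-≤-0≤ (0≤^ r (≤ᵇ⇒≤ {0ℚ} {ρ} _)) (≤ᵇ⇒≤ {1ℚ} {A} _) ⟩
    A * ρ ^ℚ r          ∎
binCDF½-Aρ^r≤primeProd r (suc k) N = begin
  F - A * ρ ^ℚ r                  ≤⟨ sub-antimonoʳ-≤ F (binCDF½*tailSum≤Aρ^r r k N) ⟩
  F - F * tailSum r (suc k) N     ≡⟨ solve 2 (λ F t → F :- F :* t := F :* (con 1ℚ :- t)) refl F (tailSum r (suc k) N) ⟩
  F * (1ℚ - tailSum r (suc k) N)  ≤⟨ binCDF½*[1-tailSum]≤primeProd r (suc k) N ⟩
  primeProd r (suc k) N           ∎
  where
  open ℚ.≤-Reasoning
  F = binCDF r ½ (suc k)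

theorem1 : Σ ℚ λ A → Σ ℚ λ q → (0ℚ < A) × (0ℚ < q) × (q < 1ℚ) ×
    ((r : ℕ) → 2 ≤ r → (k : ℕ) →
      ((ε : ℚ) → 0ℚ < ε → Σ ℕ λ N → primeProd r k N ≤ℚ binCDF r (inv 2) k + ε)
      × ((N : ℕ) → binCDF r (inv 2) k - A * (q ^ℚ r) ≤ℚ primeProd r k N))
theorem1 = A , ρ , toWitness {a? = 0ℚ ℚ.<? A} _ , toWitness {a? = 0ℚ ℚ.<? ρ} _ , toWitness {a? = ρ ℚ.<? 1ℚ} _ ,
  λ r _ k → (λ ε 0<ε → 2 , primeProd-2≤ r k ε (ℚ.<⇒≤ 0<ε)) , binCDF½-Aρ^r≤primeProd r k
  where
  primeProd-2≤ : ∀ r k ε → 0ℚ ≤ℚ ε → primeProd r k 2 ≤ℚ binCDF r ½ k + ε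
  primeProd-2≤ r k ε 0≤ε = subst (_≤ℚ binCDF r ½ k + ε) (sym (ℚ.*-identityʳ (binCDF r ½ k))) (≤-from-gap ε 0≤ε refl)
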